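{- Let $r=(0,x,x,x)^T$ with $x$ a nonnegative integer. For $n=4m+i$ with $m\ge 0$ and $0\le i\le 3$, let $R_n=R_i(S_4S_3S_2S_1)^m$, where $R_0=I$, $R_1=S_1$, $R_2=S_2S_1$, $R_3=S_3S_2S_1$. Then for every reduced word $w$ of length $n$ in the generators $S_1,\dots,S_4$, $$\|wr\|_\infty\le \|R_nr\|_\infty = O\!\left(\gamma^{n/4}\right),\qquad \gamma=\frac14\left(7+\sqrt{13}+2\sqrt{\tfrac{75}{2}+\tfrac{21\sqrt{13}}{2}}\right)\approx 8.795,$$ where $\gamma$ is the largest root of $t^4-7t^3-15t^2-7t+1$, the characteristic polynomial of $S_4S_3S_2S_1$.
   Context: The triangle group $T\subset GL(4,\mathbb{Z})$ is generated by $S_1=\begin{pmatrix}-1&1&1&1\\0&1&0&0\\0&0&1&0\\0&0&0&1\end{pmatrix}$, $S_2=\begin{pmatrix}1&0&0&0\\1&-1&1&1\\0&0&1&0\\0&0&0&1\end{pmatrix}$, $S_3=\begin{pmatrix}1&0&0&0\\0&1&0&0\\1&1&-1&1\\0&0&0&1\end{pmatrix}$, $S_4=\begin{pmatrix}1&0&0&0\\0&1&0&0\\0&0&1&0\\1&1&1&-1\end{pmatrix}$, acting on column vectors. A word in $S_1,\dots,S_4$ is reduced if it is not equal in $T$ to a word of smaller length. For a column vector $v=(a,b,c,d)^T$ with nonnegative entries, $\|v\|_\infty=\max(a,b,c,d)$. -}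

module Defs where

open import Data.Nat as ℕ using (ℕ; zero; suc; _⊔_; _%_; _/_)
open import Data.Integer as ℤ using (ℤ; +_; ∣_∣)
open import Data.Fin using (Fin; zero; suc)
open import Data.Vec as Vec using (Vec; []; _∷_)
open import Data.List as List using (List; []; _∷_; _++_; length; concat; replicate)
open import Data.Rational as ℚ using (ℚ; 0ℚ; 1ℚ)
open import Relation.Binary.PropositionalEquality using (_≡_)

-- 4x4 integer matrices (row-major), acting on column vectors
Mat : Set
Mat = Vec (Vec ℤ 4) 4

dot : ∀ {n} → Vec ℤ n → Vec ℤ n → ℤ
dot u v = Vec.foldr _ ℤ._+_ (+ 0) (Vec.zipWith ℤ._*_ u v)

_·_ : Mat → Vec ℤ 4 → Vec ℤ 4
M · v = Vec.map (λ row → dot row v) M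

_⊗_ : Mat → Mat → Mat
A ⊗ B = Vec.map (λ row → Vec.map (dot row) (Vec.transpose B)) A

I₄ : Mat
I₄ = (+ 1 ∷ + 0 ∷ + 0 ∷ + 0 ∷ [])
   ∷ (+ 0 ∷ + 1 ∷ + 0 ∷ + 0 ∷ [])
   ∷ (+ 0 ∷ + 0 ∷ + 1 ∷ + 0 ∷ [])
   ∷ (+ 0 ∷ + 0 ∷ + 0 ∷ + 1 ∷ [])
   ∷ []

-1ℤ : ℤ
-1ℤ = ℤ.- (+ 1)

-- generators S₁..S₄ (indexed by Fin 4: zero = S₁, …, suc (suc (suc zero)) = S₄)
S : Fin 4 → Mat
S zero =
     (-1ℤ ∷ + 1 ∷ + 1 ∷ + 1 ∷ [])
   ∷ (+ 0 ∷ + 1 ∷ + 0 ∷ + 0 ∷ [])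
   ∷ (+ 0 ∷ + 0 ∷ + 1 ∷ + 0 ∷ [])
   ∷ (+ 0 ∷ + 0 ∷ + 0 ∷ + 1 ∷ [])
   ∷ []
S (suc zero) =
     (+ 1 ∷ + 0 ∷ + 0 ∷ + 0 ∷ [])
   ∷ (+ 1 ∷ -1ℤ ∷ + 1 ∷ + 1 ∷ [])
   ∷ (+ 0 ∷ + 0 ∷ + 1 ∷ + 0 ∷ [])
   ∷ (+ 0 ∷ + 0 ∷ + 0 ∷ + 1 ∷ [])
   ∷ []
S (suc (suc zero)) =
     (+ 1 ∷ + 0 ∷ + 0 ∷ + 0 ∷ [])
   ∷ (+ 0 ∷ + 1 ∷ + 0 ∷ + 0 ∷ [])
   ∷ (+ 1 ∷ + 1 ∷ -1ℤ ∷ + 1 ∷ [])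
   ∷ (+ 0 ∷ + 0 ∷ + 0 ∷ + 1 ∷ [])
   ∷ []
S (suc (suc (suc zero))) =
     (+ 1 ∷ + 0 ∷ + 0 ∷ + 0 ∷ [])
   ∷ (+ 0 ∷ + 1 ∷ + 0 ∷ + 0 ∷ [])
   ∷ (+ 0 ∷ + 0 ∷ + 1 ∷ + 0 ∷ [])
   ∷ (+ 1 ∷ + 1 ∷ + 1 ∷ -1ℤ ∷ [])
   ∷ []

Word : Set
Word = List (Fin 4)

eval : Word → Mat
eval []      = I₄
eval (s ∷ w) = S s ⊗ eval w

Reduced : Word → Set
Reduced w = ∀ (w' : Word) → eval w' ≡ eval w → length w ℕ.≤ length w'

norm∞ : ∀ {n} → Vec ℤ n → ℕ
norm∞ v = Vec.foldr _ _⊔_ 0 (Vec.map ∣_∣ v)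

rvec : ℕ → Vec ℤ 4
rvec x = + 0 ∷ + x ∷ + x ∷ + x ∷ []

s₁ s₂ s₃ s₄ : Fin 4
s₁ = zero
s₂ = suc zero
s₃ = suc (suc zero)
s₄ = suc (suc (suc zero))

Rprefix : ℕ → Word
Rprefix 0 = []
Rprefix 1 = s₁ ∷ []
Rprefix 2 = s₂ ∷ s₁ ∷ []
Rprefix _ = s₃ ∷ s₂ ∷ s₁ ∷ []

Rword : ℕ → Word
Rword n = Rprefix (n % 4) ++ concat (replicate (n / 4) (s₄ ∷ s₃ ∷ s₂ ∷ s₁ ∷ []))

R : ℕ → Mat
R n = eval (Rword n)

_^ℚ_ : ℚ → ℕ → ℚ
q ^ℚ zero  = 1ℚ
q ^ℚ suc n = q ℚ.* (q ^ℚ n)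

ℚof : ℕ → ℚ
ℚof n = (+ n) ℚ./ 1

charpoly : ℚ → ℚ
charpoly t = (t ^ℚ 4) ℚ.- (ℚof 7 ℚ.* (t ^ℚ 3)) ℚ.- (ℚof 15 ℚ.* (t ^ℚ 2))
             ℚ.- (ℚof 7 ℚ.* t) ℚ.+ 1ℚ

-- "t > γ" where γ is the largest real root of charpoly, expressed over ℚ:
-- the polynomial is positive at every rational s ≥ t.
-- (γ is an irrational simple root and charpoly < 0 just left of γ, so for
--  rational t this holds iff t > γ.)
AboveGamma : ℚ → Set
AboveGamma t = ∀ (s : ℚ) → t ℚ.≤ s → 0ℚ ℚ.< charpoly s

-- Each Sᵢ replaces vᵢ by (Σ_{j ≠ i} vⱼ) - vᵢ. This reflection preserves the quadratic form
-- (Σ v)² - 3 Σ v², on whose null cone r lies. Along Rₙ every step reflects the smallest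
-- coordinate, so Rₙ r is x (τₙ, τₙ₊₁, τₙ₊₂, τₙ₊₃) up to order, where τₙ₊₄ = τₙ₊₃ + τₙ₊₂ + τₙ₊₁ - τₙ.
-- For any word of length n, reduced or not, the entries in increasing order stay below
-- x (τₙ, …, τₙ₊₃): on the null cone the reflected coordinate is monotone in the other three,
-- so the bound survives each letter and ‖w r‖ ≤ x τₙ₊₃ = ‖Rₙ r‖. Finally, when q⁴ > γ the
-- characteristic polynomial q⁴ - q³ - q² - q + 1 of the recurrence is nonnegative, and then
-- L n = q³ τₙ₊₃ + (q² + q - 1) τₙ₊₂ + (q² - q) τₙ₊₁ - q² τₙ satisfies L (n + 1) ≤ q L n,
-- which gives τₙ₊₃ ≤ 3 qⁿ.

module Submission where

open import Data.Nat using (ℕ)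

module Reflection where
  open import Data.Fin using (Fin)
  open import Data.Fin.Patterns using (0F; 1F; 2F; 3F)
  open import Data.Integer
  open import Data.Integer.Properties
  open import Data.Integer.Tactic.RingSolver
  import Data.Nat as ℕ
  open import Relation.Binary.PropositionalEquality
  open import Relation.Nullary using (yes; no)
  open import Relation.Nullary.Negation using (contradiction)

  Σ₄ : (Fin 4 → ℤ) → ℤ
  Σ₄ g = g 0F + g 1F + g 2F + g 3F

  quadForm : (Fin 4 → ℤ) → ℤ
  quadForm g = Σ₄ g * Σ₄ g - + 3 * Σ₄ (λ i → g i * g i)

  Σ₄-cong : ∀ {g h} → g ≗ h → Σ₄ g ≡ Σ₄ h
  Σ₄-cong g≗h = cong₂ _+_ (cong₂ _+_ (cong₂ _+_ (g≗h 0F) (g≗h 1F)) (g≗h 2F)) (g≗h 3F)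

  quadForm-cong : ∀ {g h} → g ≗ h → quadForm g ≡ quadForm h
  quadForm-cong g≗h =
    cong₂ (λ s q → s * s - + 3 * q) (Σ₄-cong g≗h) (Σ₄-cong (λ i → cong₂ _*_ (g≗h i) (g≗h i)))

  Null : (Fin 4 → ℤ) → Set
  Null g = quadForm g ≡ 0ℤ

  reflected : (Fin 4 → ℤ) → ℤ
  reflected g = g 0F + g 1F + g 2F - g 3F

  reflectLast : (Fin 4 → ℤ) → Fin 4 → ℤ
  reflectLast g 3F = reflected g
  reflectLast g i  = g i

  reflectLast-cong : ∀ {g h} → g ≗ h → reflectLast g ≗ reflectLast h
  reflectLast-cong g≗h 0F = g≗h 0F
  reflectLast-cong g≗h 1F = g≗h 1F
  reflectLast-cong g≗h 2F = g≗h 2F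
  reflectLast-cong g≗h 3F = cong₂ _-_ (cong₂ _+_ (cong₂ _+_ (g≗h 0F) (g≗h 1F)) (g≗h 2F)) (g≗h 3F)

  quadForm-reflectLast : ∀ g → quadForm (reflectLast g) ≡ quadForm g
  quadForm-reflectLast g = identity (g 0F) (g 1F) (g 2F) (g 3F)
    where
    identity : ∀ a b c d →
      (a + b + c + (a + b + c - d)) * (a + b + c + (a + b + c - d))
        - + 3 * (a * a + b * b + c * c + (a + b + c - d) * (a + b + c - d))
      ≡ (a + b + c + d) * (a + b + c + d) - + 3 * (a * a + b * b + c * c + d * d)
    identity = solve-∀

  Null-reflectLast : ∀ {g} → Null g → Null (reflectLast g)
  Null-reflectLast {g} = trans (quadForm-reflectLast g)

  square-nonNeg : ∀ i → 0ℤ ≤ i * i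
  square-nonNeg (+ n)    = subst (0ℤ ≤_) (pos-* n n) (+≤+ ℕ.z≤n)
  square-nonNeg -[1+ n ] = +≤+ ℕ.z≤n

  *-nonNeg : ∀ {i j} → 0ℤ ≤ i → 0ℤ ≤ j → 0ℤ ≤ i * j
  *-nonNeg {+ m} {+ n} _ _ = subst (0ℤ ≤_) (pos-* m n) (+≤+ ℕ.z≤n)

  +-nonNeg : ∀ {i j} → 0ℤ ≤ i → 0ℤ ≤ j → 0ℤ ≤ i + j
  +-nonNeg = +-mono-≤

  -- On the null cone 2 w (x + y + z - w) is a sum of squares, so for w > 0 the reflection is nonnegative.
  reflected-nonNeg : ∀ {g} → Null g → (∀ i → 0ℤ ≤ g i) → 0ℤ ≤ reflected g
  reflected-nonNeg {g} null nonNeg =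
    cancel-w (g 3F) (nonNeg 3F) (trans (identity x y z (g 3F)) (cong (λ t → squares + t) null))
    where
    x = g 0F
    y = g 1F
    z = g 2F
    identity : ∀ x y z w →
      + 2 * (x + y + z - w) * w
        ≡ (x - y) * (x - y) + (y - z) * (y - z) + (z - x) * (z - x)
          + ((x + y + z + w) * (x + y + z + w) - + 3 * (x * x + y * y + z * z + w * w))
    identity = solve-∀
    squares = (x - y) * (x - y) + (y - z) * (y - z) + (z - x) * (z - x)
    squares-nonNeg : 0ℤ ≤ squares + 0ℤ
    squares-nonNeg =
      +-nonNeg (+-nonNeg (+-nonNeg (square-nonNeg (x - y)) (square-nonNeg (y - z))) (square-nonNeg (z - x))) ≤-refl
    cancel-w : ∀ w → 0ℤ ≤ w → + 2 * (x + y + z - w) * w ≡ squares + 0ℤ → 0ℤ ≤ x + y + z - w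
    cancel-w (+ 0) _ _ = subst (0ℤ ≤_) (sym (+-identityʳ (x + y + z)))
      (+-nonNeg (+-nonNeg (nonNeg 0F) (nonNeg 1F)) (nonNeg 2F))
    cancel-w w@(+[1+ _ ]) _ e = *-cancelˡ-≤-pos 0ℤ _ (+ 2)
      (*-cancelʳ-≤-pos (+ 2 * 0ℤ) (+ 2 * (x + y + z - w)) w (subst (0ℤ ≤_) (sym e) squares-nonNeg))

  record Admissible (β : Fin 4 → ℤ) : Set where
    field
      nonNeg₀  : 0ℤ ≤ β 0F
      sorted₀₁ : β 0F ≤ β 1F
      sorted₁₂ : β 1F ≤ β 2F
      sorted₂₃ : β 2F ≤ β 3F
      null     : Null β
      spread   : β 0F + β 3F ≤ + 2 * (β 1F + β 2F)

  ≤-from-squares : ∀ {i j} → 0ℤ ≤ j → i * i ≤ j * j → i ≤ j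
  ≤-from-squares {i} {j} 0≤j i²≤j² with i ≤? j
  ... | yes i≤j = i≤j
  ... | no  i≰j = contradiction i²≤j² (<⇒≱ j²<i²)
    where
    j<i = ≰⇒> i≰j
    j²<i² : j * j < i * i
    j²<i² = ≤-<-trans (*-monoˡ-≤-nonNeg j {{nonNegative 0≤j}} (<⇒≤ j<i))
                      (*-monoʳ-<-pos i {{positive (≤-<-trans 0≤j j<i)}} j<i)

  gap-linear : ∀ x y z w a b c d →
    (b - x) + (c - y) + (d - z) + ((b - a) + (c - a) + d) - (x + y + z - + 2 * w)
      ≡ + 2 * ((b + c + d - a) - (x + y + z - w))
  gap-linear = solve-∀

  gap-squares : ∀ x y z w a b c d →
    let U = (b - x) + (c - y) + (d - z) + ((b - a) + (c - a) + d)
        u = x + y + z - + 2 * w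
    in U * U - u * u
       ≡ + 4 * ((c - b + (d - a) + c + d) * (b - x) + (b - a + (d - c) + b + d) * (c - y)
                + (+ 2 * (b + c) - (a + d)) * (d - z))
         + + 2 * (((b - x) - (c - y)) * ((b - x) - (c - y)) + ((c - y) - (d - z)) * ((c - y) - (d - z))
                  + ((d - z) - (b - x)) * ((d - z) - (b - x)))
         + + 2 * ((x + y + z + w) * (x + y + z + w) - + 3 * (x * x + y * y + z * z + w * w))
         - + 2 * ((a + b + c + d) * (a + b + c + d) - + 3 * (a * a + b * b + c * c + d * d))
  gap-squares = solve-∀

  -- With u = x + y + z - 2w and U = 2 (b + c + d - a) - (x + y + z), the difference U² - u² is a nonnegative
  -- combination of the slacks b - x, c - y, d - z and of squares, once both quadratic forms vanish.
  reflected-≤ : ∀ {g β} → Admissible β → Null g →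
                g 0F ≤ β 1F → g 1F ≤ β 2F → g 2F ≤ β 3F →
                reflected g ≤ β 1F + β 2F + β 3F - β 0F
  reflected-≤ {g} {β} adm null-g x≤b y≤c z≤d =
    0≤i-j⇒j≤i (*-cancelˡ-≤-pos 0ℤ _ (+ 2) (subst (0ℤ ≤_) (gap-linear x y z w a b c d) (i≤j⇒0≤j-i u≤U)))
    where
    open Admissible adm
    x = g 0F
    y = g 1F
    z = g 2F
    w = g 3F
    a = β 0F
    b = β 1F
    c = β 2F
    d = β 3F
    a≤c = ≤-trans sorted₀₁ sorted₁₂
    a≤d = ≤-trans a≤c sorted₂₃
    0≤b = ≤-trans nonNeg₀ sorted₀₁
    0≤c = ≤-trans 0≤b sorted₁₂
    0≤d = ≤-trans 0≤c sorted₂₃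
    slack : ∀ {i j} → i ≤ j → 0ℤ ≤ j - i
    slack = i≤j⇒0≤j-i
    0≤const : ∀ n → 0ℤ ≤ + n
    0≤const n = +≤+ ℕ.z≤n

    u = x + y + z - + 2 * w
    U = (b - x) + (c - y) + (d - z) + ((b - a) + (c - a) + d)
    sq = λ t → t * t
    P = + 4 * ((c - b + (d - a) + c + d) * (b - x) + (b - a + (d - c) + b + d) * (c - y)
               + (+ 2 * (b + c) - (a + d)) * (d - z))
        + + 2 * (sq ((b - x) - (c - y)) + sq ((c - y) - (d - z)) + sq ((d - z) - (b - x)))

    drop-zeros : ∀ p → p + + 2 * 0ℤ - + 2 * 0ℤ ≡ p
    drop-zeros = solve-∀

    U²-u² : U * U - u * u ≡ P
    U²-u² = begin
      U * U - u * u                                  ≡⟨ gap-squares x y z w a b c d ⟩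
      P + + 2 * quadForm g - + 2 * quadForm β         ≡⟨ cong₂ (λ p q → P + + 2 * p - + 2 * q) null-g null ⟩
      P + + 2 * 0ℤ - + 2 * 0ℤ                        ≡⟨ drop-zeros P ⟩
      P                                              ∎
      where open ≡-Reasoning

    0≤P : 0ℤ ≤ P
    0≤P = +-nonNeg
      (*-nonNeg (0≤const 4) (+-nonNeg (+-nonNeg
        (*-nonNeg (+-nonNeg (+-nonNeg (+-nonNeg (slack sorted₁₂) (slack a≤d)) 0≤c) 0≤d) (slack x≤b))
        (*-nonNeg (+-nonNeg (+-nonNeg (+-nonNeg (slack sorted₀₁) (slack sorted₂₃)) 0≤b) 0≤d) (slack y≤c)))
        (*-nonNeg (slack spread) (slack z≤d))))
      (*-nonNeg (0≤const 2) (+-nonNeg (+-nonNeg (square-nonNeg ((b - x) - (c - y)))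
                                               (square-nonNeg ((c - y) - (d - z))))
                                     (square-nonNeg ((d - z) - (b - x)))))

    0≤U : 0ℤ ≤ U
    0≤U = +-nonNeg (+-nonNeg (+-nonNeg (slack x≤b) (slack y≤c)) (slack z≤d))
                   (+-nonNeg (+-nonNeg (slack sorted₀₁) (slack a≤c)) 0≤d)

    u≤U : u ≤ U
    u≤U = ≤-from-squares 0≤U (0≤i-j⇒j≤i (subst (0ℤ ≤_) (sym U²-u²) 0≤P))

module Action where
  open import Defs
  open import Data.Fin as Fin using (Fin; toℕ; inject₁; punchIn)
  open import Data.Fin.Patterns using (0F; 1F; 2F; 3F)
  open import Data.Fin.Permutation as Perm using (Permutation′; _⟨$⟩ʳ_; _⟨$⟩ˡ_)
  open import Data.Integer hiding (-1ℤ)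
  import Data.Nat as ℕ
  import Data.Nat.Properties as ℕ
  open import Data.Integer.Properties using (+-0-commutativeMonoid)
  open import Data.Integer.Tactic.RingSolver
  import Data.List as List
  open import Data.Vec as Vec using (Vec; []; _∷_; lookup; _[_]≔_)
  open import Data.Vec.Properties using (map-∘; map-cong; lookup∘update; lookup∘update′)
  open import Algebra.Properties.CommutativeMonoid.Sum +-0-commutativeMonoid using (sum; sum-permute)
  open import Function using (_∘_)
  open import Relation.Binary.PropositionalEquality
  open Reflection

  vec₄-cong : ∀ {a b c d a′ b′ c′ d′ : ℤ} → a ≡ a′ → b ≡ b′ → c ≡ c′ → d ≡ d′ →
              a ∷ b ∷ c ∷ d ∷ [] ≡ a′ ∷ b′ ∷ c′ ∷ d′ ∷ []
  vec₄-cong refl refl refl refl = refl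

  unit₀ : ∀ a b c d → + 1 * a + (+ 0 * b + (+ 0 * c + (+ 0 * d + + 0))) ≡ a
  unit₀ = solve-∀
  unit₁ : ∀ a b c d → + 0 * a + (+ 1 * b + (+ 0 * c + (+ 0 * d + + 0))) ≡ b
  unit₁ = solve-∀
  unit₂ : ∀ a b c d → + 0 * a + (+ 0 * b + (+ 1 * c + (+ 0 * d + + 0))) ≡ c
  unit₂ = solve-∀
  unit₃ : ∀ a b c d → + 0 * a + (+ 0 * b + (+ 0 * c + (+ 1 * d + + 0))) ≡ d
  unit₃ = solve-∀
  reflection₀ : ∀ a b c d → -1ℤ * a + (+ 1 * b + (+ 1 * c + (+ 1 * d + + 0))) ≡ a + b + c + d - + 2 * a
  reflection₀ = solve-∀
  reflection₁ : ∀ a b c d → + 1 * a + (-1ℤ * b + (+ 1 * c + (+ 1 * d + + 0))) ≡ a + b + c + d - + 2 * b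
  reflection₁ = solve-∀
  reflection₂ : ∀ a b c d → + 1 * a + (+ 1 * b + (-1ℤ * c + (+ 1 * d + + 0))) ≡ a + b + c + d - + 2 * c
  reflection₂ = solve-∀
  reflection₃ : ∀ a b c d → + 1 * a + (+ 1 * b + (+ 1 * c + (-1ℤ * d + + 0))) ≡ a + b + c + d - + 2 * d
  reflection₃ = solve-∀

  I₄-· : ∀ v → I₄ · v ≡ v
  I₄-· (a ∷ b ∷ c ∷ d ∷ []) = vec₄-cong (unit₀ a b c d) (unit₁ a b c d) (unit₂ a b c d) (unit₃ a b c d)

  S-action : ∀ s v → S s · v ≡ v [ s ]≔ (Σ₄ (lookup v) - + 2 * lookup v s)
  S-action 0F (a ∷ b ∷ c ∷ d ∷ []) = vec₄-cong (reflection₀ a b c d) (unit₁ a b c d) (unit₂ a b c d) (unit₃ a b c d)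
  S-action 1F (a ∷ b ∷ c ∷ d ∷ []) = vec₄-cong (unit₀ a b c d) (reflection₁ a b c d) (unit₂ a b c d) (unit₃ a b c d)
  S-action 2F (a ∷ b ∷ c ∷ d ∷ []) = vec₄-cong (unit₀ a b c d) (unit₁ a b c d) (reflection₂ a b c d) (unit₃ a b c d)
  S-action 3F (a ∷ b ∷ c ∷ d ∷ []) = vec₄-cong (unit₀ a b c d) (unit₁ a b c d) (unit₂ a b c d) (reflection₃ a b c d)

  dot-transpose : ∀ (row : Vec ℤ 4) N v → dot (Vec.map (dot row) (Vec.transpose N)) v ≡ dot row (N · v)
  dot-transpose (m₀ ∷ m₁ ∷ m₂ ∷ m₃ ∷ [])
    ((n₀₀ ∷ n₀₁ ∷ n₀₂ ∷ n₀₃ ∷ []) ∷ (n₁₀ ∷ n₁₁ ∷ n₁₂ ∷ n₁₃ ∷ []) ∷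
     (n₂₀ ∷ n₂₁ ∷ n₂₂ ∷ n₂₃ ∷ []) ∷ (n₃₀ ∷ n₃₁ ∷ n₃₂ ∷ n₃₃ ∷ []) ∷ [])
    (v₀ ∷ v₁ ∷ v₂ ∷ v₃ ∷ []) =
    identity m₀ m₁ m₂ m₃ n₀₀ n₀₁ n₀₂ n₀₃ n₁₀ n₁₁ n₁₂ n₁₃ n₂₀ n₂₁ n₂₂ n₂₃ n₃₀ n₃₁ n₃₂ n₃₃ v₀ v₁ v₂ v₃
    where
    identity : ∀ m₀ m₁ m₂ m₃ n₀₀ n₀₁ n₀₂ n₀₃ n₁₀ n₁₁ n₁₂ n₁₃ n₂₀ n₂₁ n₂₂ n₂₃ n₃₀ n₃₁ n₃₂ n₃₃ v₀ v₁ v₂ v₃ →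
      (m₀ * n₀₀ + (m₁ * n₁₀ + (m₂ * n₂₀ + (m₃ * n₃₀ + + 0)))) * v₀
        + ((m₀ * n₀₁ + (m₁ * n₁₁ + (m₂ * n₂₁ + (m₃ * n₃₁ + + 0)))) * v₁
        + ((m₀ * n₀₂ + (m₁ * n₁₂ + (m₂ * n₂₂ + (m₃ * n₃₂ + + 0)))) * v₂
        + ((m₀ * n₀₃ + (m₁ * n₁₃ + (m₂ * n₂₃ + (m₃ * n₃₃ + + 0)))) * v₃ + + 0)))
      ≡ m₀ * (n₀₀ * v₀ + (n₀₁ * v₁ + (n₀₂ * v₂ + (n₀₃ * v₃ + + 0))))
        + (m₁ * (n₁₀ * v₀ + (n₁₁ * v₁ + (n₁₂ * v₂ + (n₁₃ * v₃ + + 0))))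
        + (m₂ * (n₂₀ * v₀ + (n₂₁ * v₁ + (n₂₂ * v₂ + (n₂₃ * v₃ + + 0))))
        + (m₃ * (n₃₀ * v₀ + (n₃₁ * v₁ + (n₃₂ * v₂ + (n₃₃ * v₃ + + 0)))) + + 0)))
    identity = solve-∀

  ⊗-· : ∀ M N v → (M ⊗ N) · v ≡ M · (N · v)
  ⊗-· M N v = begin
    (M ⊗ N) · v
      ≡⟨ map-∘ _ _ M ⟨
    Vec.map (λ row → dot (Vec.map (dot row) (Vec.transpose N)) v) M
      ≡⟨ map-cong (λ row → dot-transpose row N v) M ⟩
    M · (N · v) ∎
    where open ≡-Reasoning

  act : Word → Vec ℤ 4 → Vec ℤ 4
  act w v = List.foldr (λ s u → S s · u) v w

  eval-· : ∀ w v → eval w · v ≡ act w v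
  eval-· List.[]      v = I₄-· v
  eval-· (s List.∷ w) v = trans (⊗-· (S s) (eval w) v) (cong (S s ·_) (eval-· w v))

  Σ₄-permute : ∀ g (π : Permutation′ 4) → Σ₄ (g ∘ (π ⟨$⟩ʳ_)) ≡ Σ₄ g
  Σ₄-permute g π = begin
    Σ₄ (g ∘ (π ⟨$⟩ʳ_)) ≡⟨ Σ₄-sum (g ∘ (π ⟨$⟩ʳ_)) ⟩
    sum (g ∘ (π ⟨$⟩ʳ_)) ≡⟨ sum-permute g π ⟨
    sum g              ≡⟨ Σ₄-sum g ⟨
    Σ₄ g               ∎
    where
    open ≡-Reasoning
    identity : ∀ a b c d → a + b + c + d ≡ a + (b + (c + (d + + 0)))
    identity = solve-∀
    Σ₄-sum : ∀ h → Σ₄ h ≡ sum h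
    Σ₄-sum h = identity (h 0F) (h 1F) (h 2F) (h 3F)

  Null-permute : ∀ {g} (π : Permutation′ 4) → Null g → Null (g ∘ (π ⟨$⟩ʳ_))
  Null-permute {g} π =
    trans (cong₂ (λ s q → s * s - + 3 * q) (Σ₄-permute g π) (Σ₄-permute (λ i → g i * g i) π))

  -- toLast p sends 3F to p and 0F, 1F, 2F increasingly onto the remaining positions.
  toLast : Fin 4 → Permutation′ 4
  toLast p = Perm.insert 3F p Perm.id

  toLast-inject₁ : ∀ p k → toLast p ⟨$⟩ʳ inject₁ k ≡ punchIn p k
  toLast-inject₁ p 0F = Perm.insert-punchIn 3F p Perm.id 0F
  toLast-inject₁ p 1F = Perm.insert-punchIn 3F p Perm.id 1F
  toLast-inject₁ p 2F = Perm.insert-punchIn 3F p Perm.id 2F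

  toℕ-punchIn : ∀ {n} (i : Fin (ℕ.suc n)) (j : Fin n) → toℕ (punchIn i j) ℕ.≤ ℕ.suc (toℕ j)
  toℕ-punchIn Fin.zero    j           = ℕ.≤-refl
  toℕ-punchIn (Fin.suc i) Fin.zero    = ℕ.z≤n
  toℕ-punchIn (Fin.suc i) (Fin.suc j) = ℕ.s≤s (toℕ-punchIn i j)

  S-fixes : ∀ {s i} v → i ≢ s → lookup (S s · v) i ≡ lookup v i
  S-fixes {s} {i} v i≢s = trans (cong (λ u → lookup u i) (S-action s v)) (lookup∘update′ i≢s v _)

  permute-≢ : ∀ (σ : Permutation′ 4) {i j} → i ≢ j → σ ⟨$⟩ʳ i ≢ σ ⟨$⟩ʳ j
  permute-≢ σ {i} {j} i≢j σi≡σj = i≢j (begin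
    i                      ≡⟨ Perm.inverseˡ σ ⟨
    σ ⟨$⟩ˡ (σ ⟨$⟩ʳ i)      ≡⟨ cong (σ ⟨$⟩ˡ_) σi≡σj ⟩
    σ ⟨$⟩ˡ (σ ⟨$⟩ʳ j)      ≡⟨ Perm.inverseˡ σ ⟩
    j                      ∎)
    where open ≡-Reasoning

  S-in-frame : ∀ {s} v (σ : Permutation′ 4) → σ ⟨$⟩ʳ 3F ≡ s →
               ∀ i → lookup (S s · v) (σ ⟨$⟩ʳ i) ≡ reflectLast (lookup v ∘ (σ ⟨$⟩ʳ_)) i
  S-in-frame v σ refl 3F = begin
    lookup (S s · v) s                 ≡⟨ cong (λ u → lookup u s) (S-action s v) ⟩
    lookup (v [ s ]≔ reflection) s     ≡⟨ lookup∘update s v reflection ⟩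
    Σ₄ (lookup v) - + 2 * lookup v s   ≡⟨ cong (λ t → t - + 2 * lookup v s) (Σ₄-permute (lookup v) σ) ⟨
    Σ₄ g - + 2 * g 3F                  ≡⟨ identity (g 0F) (g 1F) (g 2F) (g 3F) ⟩
    reflected g                        ∎
    where
    open ≡-Reasoning
    g = lookup v ∘ (σ ⟨$⟩ʳ_)
    s = σ ⟨$⟩ʳ 3F
    reflection = Σ₄ (lookup v) - + 2 * lookup v s
    identity : ∀ a b c d → a + b + c + d - + 2 * d ≡ a + b + c - d
    identity = solve-∀
  S-in-frame v σ refl 0F = S-fixes v (permute-≢ σ (λ ()))
  S-in-frame v σ refl 1F = S-fixes v (permute-≢ σ (λ ()))
  S-in-frame v σ refl 2F = S-fixes v (permute-≢ σ (λ ()))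

module Sequence where
  open import Data.Nat
  open import Data.Nat.Properties
  open import Data.Sum using (inj₁; inj₂)
  open import Relation.Binary.PropositionalEquality

  -- The truncated subtraction never truncates, since τ is nondecreasing.
  τ : ℕ → ℕ
  τ 0 = 0
  τ 1 = 1
  τ 2 = 1
  τ 3 = 1
  τ (suc (suc (suc (suc k)))) = τ (suc (suc (suc k))) + τ (suc (suc k)) + τ (suc k) ∸ τ k

  τ-≤-suc : ∀ k → τ k ≤ τ (suc k)
  τ-≤-suc 0 = z≤n
  τ-≤-suc 1 = ≤-refl
  τ-≤-suc 2 = ≤-refl
  τ-≤-suc (suc (suc (suc k))) = begin
    τ (3 + k)                                    ≤⟨ m≤m+n _ _ ⟩
    τ (3 + k) + (τ (2 + k) + (τ (1 + k) ∸ τ k))  ≡⟨ +-assoc (τ (3 + k)) _ _ ⟨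
    τ (3 + k) + τ (2 + k) + (τ (1 + k) ∸ τ k)    ≡⟨ +-∸-assoc (τ (3 + k) + τ (2 + k)) (τ-≤-suc k) ⟨
    τ (4 + k)                                    ∎
    where open ≤-Reasoning

  τ-mono : ∀ {m n} → m ≤ n → τ m ≤ τ n
  τ-mono {n = zero} z≤n = ≤-refl
  τ-mono {n = suc n} m≤1+n with m≤n⇒m<n∨m≡n m≤1+n
  ... | inj₁ m<1+n = ≤-trans (τ-mono (s≤s⁻¹ m<1+n)) (τ-≤-suc n)
  ... | inj₂ refl  = ≤-refl

  τ-rec : ∀ k → τ (4 + k) + τ k ≡ τ (3 + k) + τ (2 + k) + τ (1 + k)
  τ-rec k = m∸n+n≡m (≤-trans (τ-≤-suc k) (m≤n+m _ _))

module Bounds (x : ℕ) where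
  open import Data.Fin using (Fin; toℕ)
  open import Data.Fin.Patterns using (0F; 1F; 2F; 3F)
  open import Data.Fin.Permutation using (Permutation′; _⟨$⟩ʳ_)
  open import Data.Integer
  open import Data.Integer.Properties using (+-mono-≤; 0≤i-j⇒j≤i; i≤j⇒0≤j-i)
  open import Data.Integer.Tactic.RingSolver
  import Data.Nat as ℕ
  import Data.Nat.Properties as ℕ
  open import Function using (_∘_)
  open import Relation.Binary.PropositionalEquality
  open Reflection
  open Action using (toLast; Null-permute)
  open Sequence

  T : ℕ → ℤ
  T k = + (x ℕ.* τ k)

  T-nonNeg : ∀ k → 0ℤ ≤ T k
  T-nonNeg k = +≤+ ℕ.z≤n

  T-mono : ∀ {m n} → m ℕ.≤ n → T m ≤ T n
  T-mono m≤n = +≤+ (ℕ.*-monoʳ-≤ x (τ-mono m≤n))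

  T-rec : ∀ k → T (1 ℕ.+ k) + T (2 ℕ.+ k) + T (3 ℕ.+ k) - T k ≡ T (4 ℕ.+ k)
  T-rec k = begin
    t₁ + t₂ + t₃ - t₀  ≡⟨ reorder t₀ t₁ t₂ t₃ ⟩
    t₃ + t₂ + t₁ - t₀  ≡⟨ cong (λ t → t - t₀) scaled ⟨
    t₄ + t₀ - t₀       ≡⟨ cancel t₀ t₄ ⟩
    t₄                 ∎
    where
    open ≡-Reasoning
    t₀ = T k
    t₁ = T (1 ℕ.+ k)
    t₂ = T (2 ℕ.+ k)
    t₃ = T (3 ℕ.+ k)
    t₄ = T (4 ℕ.+ k)
    scaled : t₄ + t₀ ≡ t₃ + t₂ + t₁
    scaled = cong +_ (begin
      x ℕ.* τ (4 ℕ.+ k) ℕ.+ x ℕ.* τ k    ≡⟨ ℕ.*-distribˡ-+ x _ _ ⟨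
      x ℕ.* (τ (4 ℕ.+ k) ℕ.+ τ k)        ≡⟨ cong (x ℕ.*_) (τ-rec k) ⟩
      x ℕ.* (τ (3 ℕ.+ k) ℕ.+ τ (2 ℕ.+ k) ℕ.+ τ (1 ℕ.+ k))
        ≡⟨ trans (ℕ.*-distribˡ-+ x _ _) (cong (ℕ._+ x ℕ.* τ (1 ℕ.+ k)) (ℕ.*-distribˡ-+ x _ _)) ⟩
      x ℕ.* τ (3 ℕ.+ k) ℕ.+ x ℕ.* τ (2 ℕ.+ k) ℕ.+ x ℕ.* τ (1 ℕ.+ k) ∎)
    reorder : ∀ a b c d → b + c + d - a ≡ d + c + b - a
    reorder = solve-∀
    cancel : ∀ a b → b + a - a ≡ b
    cancel = solve-∀

  -- The entries of Rₙ r in increasing order.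
  bound : ℕ → Fin 4 → ℤ
  bound n i = T (toℕ i ℕ.+ n)

  rotate : Permutation′ 4
  rotate = toLast 0F

  bound-rotate : ∀ n i → reflectLast (bound n ∘ (rotate ⟨$⟩ʳ_)) i ≡ bound (ℕ.suc n) i
  bound-rotate n 0F = refl
  bound-rotate n 1F = refl
  bound-rotate n 2F = refl
  bound-rotate n 3F = T-rec n

  bound-null : ∀ n → Null (bound n)
  bound-null ℕ.zero =
    subst (λ t → (t + y + y + y) * (t + y + y + y) - + 3 * (t * t + y * y + y * y + y * y) ≡ 0ℤ)
          (cong +_ (sym (ℕ.*-zeroʳ x))) (identity y)
    where
    y = + (x ℕ.* 1)
    identity : ∀ y → (0ℤ + y + y + y) * (0ℤ + y + y + y) - + 3 * (0ℤ * 0ℤ + y * y + y * y + y * y) ≡ 0ℤ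
    identity = solve-∀
  bound-null (ℕ.suc n) =
    trans (sym (quadForm-cong (bound-rotate n)))
          (Null-reflectLast {bound n ∘ (rotate ⟨$⟩ʳ_)} (Null-permute {bound n} rotate (bound-null n)))

  bound-spread : ∀ n → bound n 0F + bound n 3F ≤ + 2 * (bound n 1F + bound n 2F)
  bound-spread ℕ.zero = 0≤i-j⇒j≤i (subst (0ℤ ≤_) (sym (identity (T 0) (T 1)))
    (+-mono-≤ (+-mono-≤ (i≤j⇒0≤j-i (T-mono {0} {1} ℕ.z≤n)) (T-nonNeg 1)) (T-nonNeg 1)))
    where
    identity : ∀ z t → + 2 * (t + t) - (z + t) ≡ (t - z) + t + t
    identity = solve-∀
  bound-spread (ℕ.suc n) = subst (λ d → a′ + d ≤ + 2 * (b′ + c′)) (T-rec n) (0≤i-j⇒j≤i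
    (subst (0ℤ ≤_) (sym (identity (T n) a′ b′ c′))
      (+-mono-≤ (+-mono-≤ (i≤j⇒0≤j-i (T-mono {1 ℕ.+ n} (ℕ.n≤1+n _)))
                          (i≤j⇒0≤j-i (T-mono {1 ℕ.+ n} {3 ℕ.+ n} (ℕ.m≤n+m _ 2))))
                (T-nonNeg n))))
    where
    a′ = T (1 ℕ.+ n)
    b′ = T (2 ℕ.+ n)
    c′ = T (3 ℕ.+ n)
    identity : ∀ a b c d → + 2 * (c + d) - (b + (b + c + d - a)) ≡ (c - b) + (d - b) + a
    identity = solve-∀

  bound-admissible : ∀ n → Admissible (bound n)
  bound-admissible n = record
    { nonNeg₀  = T-nonNeg n
    ; sorted₀₁ = T-mono {n} (ℕ.n≤1+n n)
    ; sorted₁₂ = T-mono {1 ℕ.+ n} (ℕ.n≤1+n _)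
    ; sorted₂₃ = T-mono {2 ℕ.+ n} (ℕ.n≤1+n _)
    ; null     = bound-null n
    ; spread   = bound-spread n
    }

module Norm where
  open import Defs using (norm∞)
  open import Data.Fin as Fin using ()
  open import Data.Integer as ℤ using (ℤ; 0ℤ; +_; +≤+; ∣_∣)
  open import Data.Nat
  open import Data.Nat.Properties
  open import Data.Vec using (Vec; _∷_; []; lookup)
  open import Function using (_∘_)

  lookup≤norm∞ : ∀ {n} (v : Vec ℤ n) i → ∣ lookup v i ∣ ≤ norm∞ v
  lookup≤norm∞ (a ∷ v) Fin.zero    = m≤m⊔n _ _
  lookup≤norm∞ (a ∷ v) (Fin.suc i) = ≤-trans (lookup≤norm∞ v i) (m≤n⊔m _ _)

  norm∞-≤ : ∀ {n m} (v : Vec ℤ n) → (∀ i → ∣ lookup v i ∣ ≤ m) → norm∞ v ≤ m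
  norm∞-≤ []      _ = z≤n
  norm∞-≤ (a ∷ v) h = ⊔-lub (h Fin.zero) (norm∞-≤ v (h ∘ Fin.suc))

  ∣∣-≤ : ∀ {i m} → 0ℤ ℤ.≤ i → i ℤ.≤ + m → ∣ i ∣ ≤ m
  ∣∣-≤ {+ _} _ (+≤+ i≤m) = i≤m

module Orbits (x : ℕ) where
  open import Defs
  open import Data.Fin using (Fin; toℕ; inject₁; punchIn)
  open import Data.Fin.Patterns using (0F; 1F; 2F; 3F)
  open import Data.Fin.Properties using (toℕ≤pred[n]; toℕ-inject₁)
  open import Data.Fin.Permutation as Perm using (Permutation′; _⟨$⟩ʳ_; _⟨$⟩ˡ_; _∘ₚ_)
  open import Data.Integer as ℤ using (ℤ; 0ℤ; +_; ∣_∣)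
  import Data.Integer.Properties as ℤ
  open import Data.Nat
  open import Data.Nat.Properties
  open import Data.Product using (_×_; _,_; ∃-syntax)
  open import Data.List using (_∷_; []; _++_; concat; replicate; length)
  open import Data.Nat.DivMod using (m%n<n; m≡m%n+[m/n]*n)
  open import Data.List.Properties using (foldr-++)
  open import Data.Vec using (Vec; lookup)
  open import Function using (_∘_)
  open import Relation.Binary.PropositionalEquality
  open Reflection
  open Action
  open Sequence
  open Bounds x
  open Norm

  bound-punchIn : ∀ n p k → bound n (punchIn p k) ℤ.≤ bound (suc n) (inject₁ k)
  bound-punchIn n p k = T-mono (begin
    toℕ (punchIn p k) + n    ≤⟨ +-monoˡ-≤ n (toℕ-punchIn p k) ⟩
    suc (toℕ k + n)          ≡⟨ +-suc (toℕ k) n ⟨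
    toℕ k + suc n            ≡⟨ cong (_+ suc n) (toℕ-inject₁ k) ⟨
    toℕ (inject₁ k) + suc n  ∎)
    where open ≤-Reasoning

  bound-≤-last : ∀ n i → bound n i ℤ.≤ bound n 3F
  bound-≤-last n i = T-mono (+-monoˡ-≤ n (toℕ≤pred[n] i))

  Dominated : ℕ → (Fin 4 → ℤ) → Set
  Dominated n g = (∀ i → 0ℤ ℤ.≤ g i) × Null g × (∀ i → g i ℤ.≤ bound n i)

  Dominated-resp : ∀ {n g h} → g ≗ h → Dominated n g → Dominated n h
  Dominated-resp g≗h (nonNeg , null , below) =
    (λ i → subst (0ℤ ℤ.≤_) (g≗h i) (nonNeg i)) ,
    trans (sym (quadForm-cong g≗h)) null ,
    (λ i → subst (ℤ._≤ _) (g≗h i) (below i))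

  reflectLast-Dominated : ∀ {n h} → (∀ i → 0ℤ ℤ.≤ h i) → Null h →
                          (∀ k → h (inject₁ k) ℤ.≤ bound (suc n) (inject₁ k)) →
                          Dominated (suc n) (reflectLast h)
  reflectLast-Dominated {n} {h} nonNeg null below = nonNeg′ , Null-reflectLast {h} null , below′
    where
    nonNeg′ : ∀ i → 0ℤ ℤ.≤ reflectLast h i
    nonNeg′ 0F = nonNeg 0F
    nonNeg′ 1F = nonNeg 1F
    nonNeg′ 2F = nonNeg 2F
    nonNeg′ 3F = reflected-nonNeg {h} null nonNeg
    below′ : ∀ i → reflectLast h i ℤ.≤ bound (suc n) i
    below′ 0F = below 0F
    below′ 1F = below 1F
    below′ 2F = below 2F
    below′ 3F = ℤ.≤-trans (reflected-≤ {h} (bound-admissible n) null (below 0F) (below 1F) (below 2F))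
                          (ℤ.≤-reflexive (T-rec n))

  record Good (n : ℕ) (v : Vec ℤ 4) : Set where
    constructor good
    field
      order     : Permutation′ 4
      dominated : Dominated n (lookup v ∘ (order ⟨$⟩ʳ_))

  -- Reorder so that the reflected coordinate s comes last and the others keep their relative order.
  Good-S : ∀ {n} s v → Good n v → Good (suc n) (S s · v)
  Good-S {n} s v (good σ (nonNeg , null , below)) =
    good σ′ (Dominated-resp (λ i → sym (S-in-frame v σ′ (Perm.inverseʳ σ) i))
      (reflectLast-Dominated (nonNeg ∘ (toLast p ⟨$⟩ʳ_)) (Null-permute {g} (toLast p) null) below′))
    where
    g = lookup v ∘ (σ ⟨$⟩ʳ_)
    p = σ ⟨$⟩ˡ s
    σ′ = toLast p ∘ₚ σ
    below′ : ∀ k → lookup v (σ′ ⟨$⟩ʳ inject₁ k) ℤ.≤ bound (suc n) (inject₁ k)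
    below′ k = ℤ.≤-trans (below (toLast p ⟨$⟩ʳ inject₁ k))
      (subst (λ j → bound n j ℤ.≤ bound (suc n) (inject₁ k)) (sym (toLast-inject₁ p k)) (bound-punchIn n p k))

  record InFrame (n : ℕ) (v : Vec ℤ 4) (σ : Permutation′ 4) : Set where
    constructor inFrame
    field attains : ∀ i → lookup v (σ ⟨$⟩ʳ i) ≡ bound n i

  InFrame⇒Good : ∀ {n v σ} → InFrame n v σ → Good n v
  InFrame⇒Good {n} {σ = σ} (inFrame attains) = good σ (Dominated-resp (λ i → sym (attains i))
    ((λ i → T-nonNeg (toℕ i + n)) , bound-null n , (λ i → ℤ.≤-refl)))

  InFrame-S : ∀ {n v σ} → InFrame n v σ → InFrame (suc n) (S (σ ⟨$⟩ʳ 0F) · v) (rotate ∘ₚ σ)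
  InFrame-S {n} {v} {σ} (inFrame attains) = inFrame λ i → begin
    lookup (S (σ ⟨$⟩ʳ 0F) · v) ((rotate ∘ₚ σ) ⟨$⟩ʳ i)     ≡⟨ S-in-frame v (rotate ∘ₚ σ) refl i ⟩
    reflectLast (lookup v ∘ ((rotate ∘ₚ σ) ⟨$⟩ʳ_)) i     ≡⟨ reflectLast-cong (attains ∘ (rotate ⟨$⟩ʳ_)) i ⟩
    reflectLast (bound n ∘ (rotate ⟨$⟩ʳ_)) i             ≡⟨ bound-rotate n i ⟩
    bound (suc n) i                                     ∎
    where open ≡-Reasoning

  InFrame-resp : ∀ {n v σ τ} → (∀ i → σ ⟨$⟩ʳ i ≡ τ ⟨$⟩ʳ i) → InFrame n v σ → InFrame n v τ
  InFrame-resp {v = v} σ≈τ (inFrame attains) = inFrame λ i → trans (cong (lookup v) (sym (σ≈τ i))) (attains i)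

  block : Word
  block = s₄ ∷ s₃ ∷ s₂ ∷ s₁ ∷ []

  InFrame-block : ∀ {k v} → InFrame k v Perm.id → InFrame (4 + k) (act block v) Perm.id
  InFrame-block frame = InFrame-resp rotate⁴≈id (InFrame-S (InFrame-S (InFrame-S (InFrame-S frame))))
    where
    rotate⁴≈id : ∀ i → (rotate ∘ₚ (rotate ∘ₚ (rotate ∘ₚ (rotate ∘ₚ Perm.id)))) ⟨$⟩ʳ i ≡ i
    rotate⁴≈id 0F = refl
    rotate⁴≈id 1F = refl
    rotate⁴≈id 2F = refl
    rotate⁴≈id 3F = refl

  InFrame-initial : InFrame 0 (rvec x) Perm.id
  InFrame-initial = inFrame λ where
    0F → cong +_ (sym (*-zeroʳ x))
    1F → cong +_ (sym (*-identityʳ x))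
    2F → cong +_ (sym (*-identityʳ x))
    3F → cong +_ (sym (*-identityʳ x))

  blocks : ℕ → Word
  blocks m = concat (replicate m block)

  act-++ : ∀ p q v → act (p ++ q) v ≡ act p (act q v)
  act-++ p q v = foldr-++ _ v p q

  InFrame-blocks : ∀ m → InFrame (m * 4) (act (blocks m) (rvec x)) Perm.id
  InFrame-blocks zero    = InFrame-initial
  InFrame-blocks (suc m) =
    subst (λ u → InFrame (suc m * 4) u Perm.id) (sym (act-++ block (blocks m) (rvec x)))
          (InFrame-block (InFrame-blocks m))

  InFrame-prefix : ∀ {k v} i → i < 4 → InFrame k v Perm.id → ∃[ σ ] InFrame (i + k) (act (Rprefix i) v) σ
  InFrame-prefix 0 _ frame = _ , frame
  InFrame-prefix 1 _ frame = _ , InFrame-S frame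
  InFrame-prefix 2 _ frame = _ , InFrame-S (InFrame-S frame)
  InFrame-prefix 3 _ frame = _ , InFrame-S (InFrame-S (InFrame-S frame))
  InFrame-prefix (suc (suc (suc (suc _)))) (s≤s (s≤s (s≤s (s≤s ())))) _

  R-InFrame : ∀ n → ∃[ σ ] InFrame n (R n · rvec x) σ
  R-InFrame n with InFrame-prefix (n % 4) (m%n<n n 4) (InFrame-blocks (n / 4))
  ... | σ , frame = σ , subst₂ (λ m u → InFrame m u σ) (sym (m≡m%n+[m/n]*n n 4)) (sym R-act) frame
    where
    R-act : R n · rvec x ≡ act (Rprefix (n % 4)) (act (blocks (n / 4)) (rvec x))
    R-act = trans (eval-· (Rword n) (rvec x)) (act-++ (Rprefix (n % 4)) (blocks (n / 4)) (rvec x))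

  Good-norm : ∀ {n v} → Good n v → norm∞ v ≤ x * τ (3 + n)
  Good-norm {n} {v} (good σ (nonNeg , _ , below)) =
    norm∞-≤ v λ i → subst (λ j → ∣ lookup v j ∣ ≤ _) (Perm.inverseʳ σ) (entry (σ ⟨$⟩ˡ i))
    where
    entry : ∀ j → ∣ lookup v (σ ⟨$⟩ʳ j) ∣ ≤ x * τ (3 + n)
    entry j = ∣∣-≤ (nonNeg j) (ℤ.≤-trans (below j) (bound-≤-last n j))

  InFrame-norm : ∀ {n v σ} → InFrame n v σ → x * τ (3 + n) ≤ norm∞ v
  InFrame-norm {v = v} {σ} (inFrame attains) =
    subst (_≤ norm∞ v) (cong ∣_∣ (attains 3F)) (lookup≤norm∞ v (σ ⟨$⟩ʳ 3F))

  act-Good : ∀ w → Good (length w) (act w (rvec x))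
  act-Good []      = InFrame⇒Good InFrame-initial
  act-Good (s ∷ w) = Good-S s _ (act-Good w)

  word-norm-≤ : ∀ w → norm∞ (eval w · rvec x) ≤ norm∞ (R (length w) · rvec x)
  word-norm-≤ w with R-InFrame (length w)
  ... | _ , frame = begin
    norm∞ (eval w · rvec x)       ≡⟨ cong norm∞ (eval-· w (rvec x)) ⟩
    norm∞ (act w (rvec x))        ≤⟨ Good-norm (act-Good w) ⟩
    x * τ (3 + length w)          ≤⟨ InFrame-norm frame ⟩
    norm∞ (R (length w) · rvec x) ∎
    where open ≤-Reasoning

  R-norm : ∀ n → norm∞ (R n · rvec x) ≤ x * τ (3 + n)
  R-norm n with R-InFrame n
  ... | _ , frame = Good-norm (InFrame⇒Good frame)

module GrowthRate where
  open import Defs using (ℚof; _^ℚ_; charpoly; AboveGamma)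
  open import Data.Integer as ℤ using (+_)
  import Data.Integer.Properties as ℤ
  import Data.Nat as ℕ
  import Data.Nat.Properties as ℕ
  import Data.Nat.Coprimality as Coprime
  open import Data.Rational
  open import Data.Rational.Properties
  open import Data.Rational.Solver using (module +-*-Solver)
  open import Data.Sum using (inj₁; inj₂)
  open import Data.Unit using (tt)
  open import Relation.Binary.PropositionalEquality
  open import Relation.Nullary.Negation using (contradiction)
  open Sequence using (τ; τ-mono; τ-rec)

  open +-*-Solver

  ℚof-mkℚ : ∀ n → ℚof n ≡ mkℚ (+ n) 0 (Coprime.sym (Coprime.1-coprimeTo n))
  ℚof-mkℚ n = normalize-coprime (Coprime.sym (Coprime.1-coprimeTo n))

  ℚof-+ : ∀ m n → ℚof (m ℕ.+ n) ≡ ℚof m + ℚof n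
  ℚof-+ m n rewrite ℚof-mkℚ m | ℚof-mkℚ n =
    /-cong (sym (cong₂ ℤ._+_ (ℤ.*-identityʳ (+ m)) (ℤ.*-identityʳ (+ n)))) refl

  ℚof-* : ∀ m n → ℚof (m ℕ.* n) ≡ ℚof m * ℚof n
  ℚof-* m n rewrite ℚof-mkℚ m | ℚof-mkℚ n = /-cong (ℤ.pos-* m n) refl

  ℚof-mono : ∀ {m n} → m ℕ.≤ n → ℚof m ≤ ℚof n
  ℚof-mono {m} {n} m≤n rewrite ℚof-mkℚ m | ℚof-mkℚ n = *≤* (ℤ.*-monoʳ-≤-nonNeg (+ 1) (ℤ.+≤+ m≤n))

  ℚof-nonNeg : ∀ n → 0ℚ ≤ ℚof n
  ℚof-nonNeg n = ℚof-mono {0} {n} ℕ.z≤n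

  diff-nonNeg⇒≤ : ∀ {p q} → 0ℚ ≤ q - p → p ≤ q
  diff-nonNeg⇒≤ {p} {q} 0≤q-p = subst₂ _≤_ (+-identityʳ p) (identity p q) (+-monoʳ-≤ p 0≤q-p)
    where
    identity : ∀ p q → p + (q - p) ≡ q
    identity = solve 2 (λ p q → p :+ (q :- p) := q) refl

  ≤⇒diff-nonNeg : ∀ {p q} → p ≤ q → 0ℚ ≤ q - p
  ≤⇒diff-nonNeg {p} {q} p≤q = subst (_≤ q - p) (+-inverseʳ p) (+-monoˡ-≤ (- p) p≤q)

  *-nonNeg : ∀ {p q} → 0ℚ ≤ p → 0ℚ ≤ q → 0ℚ ≤ p * q
  *-nonNeg {p} {q} 0≤p 0≤q = subst (_≤ p * q) (*-zeroʳ p) (*-monoˡ-≤-nonNeg p {{nonNegative 0≤p}} 0≤q)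

  square-nonNeg : ∀ p → 0ℚ ≤ p * p
  square-nonNeg p with ≤-total 0ℚ p
  ... | inj₁ 0≤p = *-nonNeg 0≤p 0≤p
  ... | inj₂ p≤0 = subst (0ℚ ≤_) (identity p) (*-nonNeg (neg-antimono-≤ p≤0) (neg-antimono-≤ p≤0))
    where
    identity : ∀ p → (- p) * (- p) ≡ p * p
    identity = solve 1 (λ p → (:- p) :* (:- p) := p :* p) refl

  -- Polynomials in q ≥ 1 are shown nonnegative through their Horner form in d = q - 1.
  horner-nonNeg : ∀ {c d r} → 0ℚ ≤ c → 0ℚ ≤ d → 0ℚ ≤ r → 0ℚ ≤ c + d * r
  horner-nonNeg 0≤c 0≤d 0≤r = +-mono-≤ 0≤c (*-nonNeg 0≤d 0≤r)

  0<1 : 0ℚ < 1ℚ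
  0<1 = *<* (ℤ.+<+ (ℕ.s≤s ℕ.z≤n))

  0≤1 : 0ℚ ≤ 1ℚ
  0≤1 = <⇒≤ 0<1

  τℚ : ℕ → ℚ
  τℚ j = ℚof (τ j)

  τℚ-nonNeg : ∀ j → 0ℚ ≤ τℚ j
  τℚ-nonNeg j = ℚof-nonNeg (τ j)

  τℚ-mono : ∀ {i j} → i ℕ.≤ j → τℚ i ≤ τℚ j
  τℚ-mono i≤j = ℚof-mono (τ-mono i≤j)

  τℚ-rec : ∀ j → τℚ (4 ℕ.+ j) + τℚ j ≡ τℚ (3 ℕ.+ j) + τℚ (2 ℕ.+ j) + τℚ (1 ℕ.+ j)
  τℚ-rec j = begin
    ℚof t₄ + ℚof t₀           ≡⟨ ℚof-+ t₄ t₀ ⟨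
    ℚof (t₄ ℕ.+ t₀)           ≡⟨ cong ℚof (τ-rec j) ⟩
    ℚof (t₃ ℕ.+ t₂ ℕ.+ t₁)    ≡⟨ ℚof-+ (t₃ ℕ.+ t₂) t₁ ⟩
    ℚof (t₃ ℕ.+ t₂) + ℚof t₁  ≡⟨ cong (_+ ℚof t₁) (ℚof-+ t₃ t₂) ⟩
    ℚof t₃ + ℚof t₂ + ℚof t₁  ∎
    where
    open ≡-Reasoning
    t₀ = τ j
    t₁ = τ (1 ℕ.+ j)
    t₂ = τ (2 ℕ.+ j)
    t₃ = τ (3 ℕ.+ j)
    t₄ = τ (4 ℕ.+ j)

  charpolyτ : ℚ → ℚ
  charpolyτ q = q * q * q * q - q * q * q - q * q - q + 1ℚ

  lyapunov : ℚ → ℕ → ℚ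
  lyapunov q n =
    q * q * q * τℚ (3 ℕ.+ n) + (q * q + q - 1ℚ) * τℚ (2 ℕ.+ n) + (q * q - q) * τℚ (1 ℕ.+ n) - q * q * τℚ n

  module _ {q : ℚ} (1≤q : 1ℚ ≤ q) (charpolyτ≥0 : 0ℚ ≤ charpolyτ q) where
    private
      d = q - 1ℚ
      0≤d : 0ℚ ≤ d
      0≤d = ≤⇒diff-nonNeg 1≤q
      0≤q : 0ℚ ≤ q
      0≤q = ≤-trans 0≤1 1≤q

    lyapunov-step : ∀ n → lyapunov q (ℕ.suc n) ≤ q * lyapunov q n
    lyapunov-step n = diff-nonNeg⇒≤ (subst (0ℚ ≤_) (sym difference) (*-nonNeg charpolyτ≥0 (τℚ-nonNeg (3 ℕ.+ n))))
      where
      open ≡-Reasoning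
      a₀ = τℚ n
      a₁ = τℚ (1 ℕ.+ n)
      a₂ = τℚ (2 ℕ.+ n)
      a₃ = τℚ (3 ℕ.+ n)
      a₄ = τℚ (4 ℕ.+ n)
      identity : ∀ q a₄ a₃ a₂ a₁ a₀ →
        q * (q * q * q * a₃ + (q * q + q - 1ℚ) * a₂ + (q * q - q) * a₁ - q * q * a₀)
          - (q * q * q * a₄ + (q * q + q - 1ℚ) * a₃ + (q * q - q) * a₂ - q * q * a₁)
        ≡ (q * q * q * q - q * q * q - q * q - q + 1ℚ) * a₃ - q * q * q * ((a₄ + a₀) - (a₃ + a₂ + a₁))
      identity = solve 6 (λ q a₄ a₃ a₂ a₁ a₀ →
          q :* (q :* q :* q :* a₃ :+ (q :* q :+ q :- con 1ℚ) :* a₂ :+ (q :* q :- q) :* a₁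
            :- q :* q :* a₀)
          :- (q :* q :* q :* a₄ :+ (q :* q :+ q :- con 1ℚ) :* a₃ :+ (q :* q :- q) :* a₂
            :- q :* q :* a₁)
        := (q :* q :* q :* q :- q :* q :* q :- q :* q :- q :+ con 1ℚ) :* a₃
           :- q :* q :* q :* ((a₄ :+ a₀) :- (a₃ :+ a₂ :+ a₁))) refl
      cancel : ∀ p r s → p - r * (s - s) ≡ p
      cancel = solve 3 (λ p r s → p :- r :* (s :- s) := p) refl
      difference : q * lyapunov q n - lyapunov q (ℕ.suc n) ≡ charpolyτ q * a₃
      difference = begin
        q * lyapunov q n - lyapunov q (ℕ.suc n)
          ≡⟨ identity q a₄ a₃ a₂ a₁ a₀ ⟩
        charpolyτ q * a₃ - q * q * q * ((a₄ + a₀) - (a₃ + a₂ + a₁))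
          ≡⟨ cong (λ t → charpolyτ q * a₃ - q * q * q * (t - (a₃ + a₂ + a₁))) (τℚ-rec n) ⟩
        charpolyτ q * a₃ - q * q * q * ((a₃ + a₂ + a₁) - (a₃ + a₂ + a₁))
          ≡⟨ cancel (charpolyτ q * a₃) (q * q * q) (a₃ + a₂ + a₁) ⟩
        charpolyτ q * a₃ ∎

    lyapunov-pow : ∀ n → lyapunov q n ≤ q ^ℚ n * lyapunov q 0
    lyapunov-pow ℕ.zero    = ≤-reflexive (sym (*-identityˡ (lyapunov q 0)))
    lyapunov-pow (ℕ.suc n) = begin
      lyapunov q (ℕ.suc n)            ≤⟨ lyapunov-step n ⟩
      q * lyapunov q n                ≤⟨ *-monoˡ-≤-nonNeg q {{nonNegative 0≤q}} (lyapunov-pow n) ⟩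
      q * (q ^ℚ n * lyapunov q 0)     ≡⟨ *-assoc q (q ^ℚ n) (lyapunov q 0) ⟨
      q ^ℚ ℕ.suc n * lyapunov q 0     ∎
      where open ≤-Reasoning

    cube-≤-lyapunov : ∀ n → q * q * q * τℚ (3 ℕ.+ n) ≤ lyapunov q n
    cube-≤-lyapunov n =
      diff-nonNeg⇒≤ (subst (0ℚ ≤_) (sym (identity q (τℚ (3 ℕ.+ n)) (τℚ (2 ℕ.+ n)) (τℚ (1 ℕ.+ n)) (τℚ n)))
      (+-mono-≤ (+-mono-≤
        (*-nonNeg (horner-nonNeg 0≤1 0≤d (+-mono-≤ (ℚof-nonNeg 3) 0≤d)) (≤⇒diff-nonNeg (τℚ-mono (ℕ.m≤n+m n 2))))
        (*-nonNeg 0≤d (τℚ-nonNeg n)))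
        (*-nonNeg (horner-nonNeg ≤-refl 0≤d (+-mono-≤ 0≤1 0≤d)) (τℚ-nonNeg (1 ℕ.+ n)))))
      where
      identity : ∀ q a₃ a₂ a₁ a₀ →
        (q * q * q * a₃ + (q * q + q - 1ℚ) * a₂ + (q * q - q) * a₁ - q * q * a₀) - q * q * q * a₃
        ≡ (1ℚ + (q - 1ℚ) * (ℚof 3 + (q - 1ℚ))) * (a₂ - a₀) + (q - 1ℚ) * a₀ + (0ℚ + (q - 1ℚ) * (1ℚ + (q - 1ℚ))) * a₁
      identity = solve 5 (λ q a₃ a₂ a₁ a₀ →
          (q :* q :* q :* a₃ :+ (q :* q :+ q :- con 1ℚ) :* a₂ :+ (q :* q :- q) :* a₁
            :- q :* q :* a₀)
          :- q :* q :* q :* a₃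
        := (con 1ℚ :+ (q :- con 1ℚ) :* (con (ℚof 3) :+ (q :- con 1ℚ))) :* (a₂ :- a₀)
           :+ (q :- con 1ℚ) :* a₀
           :+ (con 0ℚ :+ (q :- con 1ℚ) :* (con 1ℚ :+ (q :- con 1ℚ))) :* a₁) refl

    lyapunov-initial : lyapunov q 0 ≤ ℚof 3 * (q * q * q)
    lyapunov-initial = diff-nonNeg⇒≤ (subst (0ℚ ≤_) (sym (identity q))
      (horner-nonNeg 0≤1 0≤d (*-nonNeg (ℚof-nonNeg 2) (square-nonNeg q))))
      where
      identity : ∀ q → ℚof 3 * (q * q * q) - (q * q * q * 1ℚ + (q * q + q - 1ℚ) * 1ℚ + (q * q - q) * 1ℚ - q * q * 0ℚ)
                       ≡ 1ℚ + (q - 1ℚ) * (ℚof 2 * (q * q))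
      identity = solve 1 (λ q →
          con (ℚof 3) :* (q :* q :* q)
          :- (q :* q :* q :* con 1ℚ :+ (q :* q :+ q :- con 1ℚ) :* con 1ℚ
            :+ (q :* q :- q) :* con 1ℚ :- q :* q :* con 0ℚ)
        := con 1ℚ :+ (q :- con 1ℚ) :* (con (ℚof 2) :* (q :* q))) refl

    1≤cube : 1ℚ ≤ q * q * q
    1≤cube = diff-nonNeg⇒≤ (subst (0ℚ ≤_) (sym (identity q))
      (horner-nonNeg ≤-refl 0≤d (horner-nonNeg (ℚof-nonNeg 3) 0≤d (+-mono-≤ (ℚof-nonNeg 3) 0≤d))))
      where
      identity : ∀ q → q * q * q - 1ℚ ≡ 0ℚ + (q - 1ℚ) * (ℚof 3 + (q - 1ℚ) * (ℚof 3 + (q - 1ℚ)))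
      identity = solve 1 (λ q →
          q :* q :* q :- con 1ℚ
        := con 0ℚ
           :+ (q :- con 1ℚ) :* (con (ℚof 3)
             :+ (q :- con 1ℚ) :* (con (ℚof 3) :+ (q :- con 1ℚ)))) refl

    τℚ-growth : ∀ n → τℚ (3 ℕ.+ n) ≤ ℚof 3 * q ^ℚ n
    τℚ-growth n = *-cancelˡ-≤-pos (q * q * q) {{positive (<-≤-trans 0<1 1≤cube)}} (begin
      q * q * q * τℚ (3 ℕ.+ n)            ≤⟨ cube-≤-lyapunov n ⟩
      lyapunov q n                       ≤⟨ lyapunov-pow n ⟩
      q ^ℚ n * lyapunov q 0
        ≤⟨ *-monoˡ-≤-nonNeg (q ^ℚ n) {{nonNegative (pow-nonNeg n)}} lyapunov-initial ⟩
      q ^ℚ n * (ℚof 3 * (q * q * q))     ≡⟨ identity (q * q * q) (q ^ℚ n) ⟩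
      q * q * q * (ℚof 3 * q ^ℚ n)       ∎)
      where
      open ≤-Reasoning
      identity : ∀ c r → r * (ℚof 3 * c) ≡ c * (ℚof 3 * r)
      identity = solve 2 (λ c r → r :* (con (ℚof 3) :* c) := c :* (con (ℚof 3) :* r)) refl
      pow-nonNeg : ∀ n → 0ℚ ≤ q ^ℚ n
      pow-nonNeg ℕ.zero    = 0≤1
      pow-nonNeg (ℕ.suc n) = *-nonNeg 0≤q (pow-nonNeg n)

  pow-≤-1 : ∀ {q} n → 0ℚ ≤ q → q ≤ 1ℚ → q ^ℚ n ≤ 1ℚ
  pow-≤-1 ℕ.zero    _   _   = ≤-refl
  pow-≤-1 {q} (ℕ.suc n) 0≤q q≤1 = begin
    q * q ^ℚ n   ≤⟨ *-monoˡ-≤-nonNeg q {{nonNegative 0≤q}} (pow-≤-1 n 0≤q q≤1) ⟩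
    q * 1ℚ       ≡⟨ *-identityʳ q ⟩
    q            ≤⟨ q≤1 ⟩
    1ℚ           ∎
    where open ≤-Reasoning

  AboveGamma⇒1≤q : ∀ {q} → 0ℚ < q → AboveGamma (q ^ℚ 4) → 1ℚ ≤ q
  AboveGamma⇒1≤q {q} 0<q above with ≤-total 1ℚ q
  ... | inj₁ 1≤q = 1≤q
  ... | inj₂ q≤1 = contradiction (<-≤-trans (above 1ℚ (pow-≤-1 4 (<⇒≤ 0<q) q≤1)) (≤ᵇ⇒≤ tt)) (<-irrefl refl)

  cofactor : ℚ → ℚ
  cofactor q = (q * q * q * q + q * q * q - q * q + q + 1ℚ)
             * ((q * q * q * q + q * q + 1ℚ) * (q * q * q * q + q * q + 1ℚ) + (q * q * q - q) * (q * q * q - q))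

  -- The eigenvalues of S₄S₃S₂S₁ are the fourth powers of the roots of charpolyτ.
  charpoly-factor : ∀ q → charpoly (q ^ℚ 4) ≡ charpolyτ q * cofactor q
  charpoly-factor = identity
    where
    identity : ∀ q → let t = q * (q * (q * (q * 1ℚ))) in
      t * (t * (t * (t * 1ℚ))) - ℚof 7 * (t * (t * (t * 1ℚ))) - ℚof 15 * (t * (t * 1ℚ)) - ℚof 7 * t + 1ℚ
      ≡ (q * q * q * q - q * q * q - q * q - q + 1ℚ)
        * ((q * q * q * q + q * q * q - q * q + q + 1ℚ)
           * ((q * q * q * q + q * q + 1ℚ) * (q * q * q * q + q * q + 1ℚ) + (q * q * q - q) * (q * q * q - q)))
    identity = solve 1 (λ q →
        let t = q :* (q :* (q :* (q :* con 1ℚ))) in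
        t :* (t :* (t :* (t :* con 1ℚ))) :- con (ℚof 7) :* (t :* (t :* (t :* con 1ℚ)))
          :- con (ℚof 15) :* (t :* (t :* con 1ℚ)) :- con (ℚof 7) :* t :+ con 1ℚ
      := (q :* q :* q :* q :- q :* q :* q :- q :* q :- q :+ con 1ℚ)
         :* ((q :* q :* q :* q :+ q :* q :* q :- q :* q :+ q :+ con 1ℚ)
             :* ((q :* q :* q :* q :+ q :* q :+ con 1ℚ) :* (q :* q :* q :* q :+ q :* q :+ con 1ℚ)
                 :+ (q :* q :* q :- q) :* (q :* q :* q :- q)))) refl

  cofactor-nonNeg : ∀ {q} → 1ℚ ≤ q → 0ℚ ≤ cofactor q
  cofactor-nonNeg {q} 1≤q = *-nonNeg (subst (0ℚ ≤_) (sym (identity q)) first)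
    (+-mono-≤ (square-nonNeg (q * q * q * q + q * q + 1ℚ)) (square-nonNeg (q * q * q - q)))
    where
    0≤d = ≤⇒diff-nonNeg 1≤q
    first = horner-nonNeg (ℚof-nonNeg 3) 0≤d (horner-nonNeg (ℚof-nonNeg 6) 0≤d
              (horner-nonNeg (ℚof-nonNeg 8) 0≤d (+-mono-≤ (ℚof-nonNeg 5) 0≤d)))
    identity : ∀ q → q * q * q * q + q * q * q - q * q + q + 1ℚ
                     ≡ ℚof 3 + (q - 1ℚ) * (ℚof 6 + (q - 1ℚ) * (ℚof 8 + (q - 1ℚ) * (ℚof 5 + (q - 1ℚ))))
    identity = solve 1 (λ q →
        q :* q :* q :* q :+ q :* q :* q :- q :* q :+ q :+ con 1ℚ
      := con (ℚof 3)
         :+ (q :- con 1ℚ) :* (con (ℚof 6)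
           :+ (q :- con 1ℚ) :* (con (ℚof 8) :+ (q :- con 1ℚ) :* (con (ℚof 5) :+ (q :- con 1ℚ))))) refl

  AboveGamma⇒0≤charpolyτ : ∀ {q} → 1ℚ ≤ q → AboveGamma (q ^ℚ 4) → 0ℚ ≤ charpolyτ q
  AboveGamma⇒0≤charpolyτ {q} 1≤q above with ≤-total 0ℚ (charpolyτ q)
  ... | inj₁ charpolyτ≥0 = charpolyτ≥0
  ... | inj₂ charpolyτ≤0 = contradiction (<-≤-trans 0<charpoly charpoly≤0) (<-irrefl refl)
    where
    0<charpoly : 0ℚ < charpolyτ q * cofactor q
    0<charpoly = subst (0ℚ <_) (charpoly-factor q) (above (q ^ℚ 4) ≤-refl)
    charpoly≤0 : charpolyτ q * cofactor q ≤ 0ℚ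
    charpoly≤0 = subst (charpolyτ q * cofactor q ≤_) (*-zeroˡ (cofactor q))
      (*-monoʳ-≤-nonNeg (cofactor q) {{nonNegative (cofactor-nonNeg 1≤q)}} charpolyτ≤0)

  scaled-growth : ∀ x n {q} → 0ℚ < q → AboveGamma (q ^ℚ 4) →
                  ℚof (x ℕ.* τ (3 ℕ.+ n)) ≤ ℚof (3 ℕ.* x) * q ^ℚ n
  scaled-growth x n {q} 0<q above = begin
    ℚof (x ℕ.* τ (3 ℕ.+ n))        ≡⟨ ℚof-* x (τ (3 ℕ.+ n)) ⟩
    ℚof x * τℚ (3 ℕ.+ n)
      ≤⟨ *-monoˡ-≤-nonNeg (ℚof x) {{nonNegative (ℚof-nonNeg x)}} (τℚ-growth 1≤q charpolyτ≥0 n) ⟩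
    ℚof x * (ℚof 3 * q ^ℚ n)       ≡⟨ identity (ℚof x) (ℚof 3) (q ^ℚ n) ⟩
    ℚof 3 * ℚof x * q ^ℚ n         ≡⟨ cong (_* q ^ℚ n) (ℚof-* 3 x) ⟨
    ℚof (3 ℕ.* x) * q ^ℚ n         ∎
    where
    open ≤-Reasoning
    1≤q = AboveGamma⇒1≤q 0<q above
    charpolyτ≥0 = AboveGamma⇒0≤charpolyτ 1≤q above
    identity : ∀ p r t → p * (r * t) ≡ r * p * t
    identity = solve 3 (λ p r t → p :* (r :* t) := r :* p :* t) refl

open import Defs
open import Data.Nat using (ℕ; _≤_)
open import Data.List using (length)
open import Data.Product using (_×_; ∃)
open import Data.Rational using (ℚ; 0ℚ; _<_)
open import Data.Rational renaming (_≤_ to _≤ℚ_; _*_ to _*ℚ_) using ()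
open import Data.Product using (_,_)
open import Data.Nat using (_*_)
import Data.Rational.Properties as ℚ

theorem4 : (x : ℕ) →
    ((w : Word) → Reduced w →
      norm∞ (eval w · rvec x) ≤ norm∞ (R (length w) · rvec x))
    × ∃ (λ (C : ℕ) → (n : ℕ) (q : ℚ) → 0ℚ < q → AboveGamma (q ^ℚ 4) →
        ℚof (norm∞ (R n · rvec x)) ≤ℚ (ℚof C *ℚ (q ^ℚ n)))
theorem4 x =
  (λ w _ → word-norm-≤ w) ,
  (3 * x , λ n q 0<q above → ℚ.≤-trans (ℚof-mono (R-norm n)) (scaled-growth x n 0<q above))
  where
  open Orbits x
  open GrowthRate
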